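{- For any signature $S$ and any $S$-term $t$, the set $\downarrow t:=\{t'\in T(S): t\preceq t'\}$ ordered by $\preceq$ is a lattice, and its join is the operation $\vee$ defined by: for $t_1,t_2\in\downarrow t$, $t_1\vee t_2$ is the $S$-term with decoration word $\mathrm{dc}(t)$ whose connection word is the componentwise maximum of $\mathrm{cnc}(t_1)$ and $\mathrm{cnc}(t_2)$ (such a term exists and lies in $\downarrow t$).
   Context: A signature is a set $S$ with an arity map $|\cdot|:S\to\mathbb N$. An $S$-term is either the leaf $\ell$ or $s\,t_1\cdots t_{|s|}$ with $s\in S$ and $S$-terms $t_i$; $T(S)$ is the set of $S$-terms. Preorder traversal: root, then subterms left to right recursively. Internal nodes of $t$ are numbered $1,\dots,\deg t$ in preorder; $\mathrm{dc}(t)$ is the word of their decorations. Children (leaves included) are numbered from $1$ left to right; the parent edge of internal node $i$ is $(\mathrm{pa}(i),\mathrm{lp}(i),i)$ where $i$ is the $\mathrm{lp}(i)$-th child of $\mathrm{pa}(i)$, with the convention $\mathrm{pa}(1)=1,\mathrm{lp}(1)=0$. Connection word: $\mathrm{cnc}(t)(i)=\mathrm{pa}(i)+1-2^{\mathrm{lp}(i)-a}$, $a$ the arity of the decoration of $\mathrm{pa}(i)$; a term is determined by its decoration word and connection word. Easterly wind order: $t_1\preceq t_2$ iff $\mathrm{dc}(t_1)=\mathrm{dc}(t_2)$ and $\mathrm{cnc}(t_1)(i)\le\mathrm{cnc}(t_2)(i)$ for all $i$. -}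

module Defs where

open import Data.Nat using (ℕ; zero; suc; _+_; _∸_)
open import Data.Integer using (+_)
open import Data.Rational using (ℚ; _/_; 1ℚ; ½; _*_; _-_; _⊔_; _≤_)
open import Data.List using (List; []; _∷_; _++_; zipWith)
open import Data.List.Relation.Binary.Pointwise using (Pointwise)
open import Data.Vec using (Vec; []; _∷_)
open import Data.Product using (Σ; _×_; _,_; proj₁; proj₂)
open import Relation.Binary.PropositionalEquality using (_≡_)

module _ {S : Set} (ar : S → ℕ) where

  data Term : Set where
    leaf : Term
    node : (s : S) → Vec Term (ar s) → Term

  mutual
    deg : Term → ℕ
    deg leaf = 0
    deg (node s ts) = suc (degs ts)

    degs : ∀ {n} → Vec Term n → ℕ
    degs [] = 0
    degs (t ∷ ts) = deg t + degs ts

  pow2inv : ℕ → ℚ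
  pow2inv zero = 1ℚ
  pow2inv (suc k) = ½ * pow2inv k

  -- pa + 1 - 2^{lp - a}   (always lp ≤ a)
  cncVal : (pa lp a : ℕ) → ℚ
  cncVal pa lp a = ((+ (suc pa)) / 1) - pow2inv (a ∸ lp)

  -- preorder walk producing, for each internal node, (decoration , connection value).
  -- walk t k p j a : t is the j-th child of internal node p (whose decoration has
  -- arity a); k is the preorder index assigned to the root of t (if internal).
  mutual
    walk : Term → (k p j a : ℕ) → List (S × ℚ)
    walk leaf k p j a = []
    walk (node s ts) k p j a = (s , cncVal p j a) ∷ walks ts (suc k) k 1 (ar s)

    walks : ∀ {n} → Vec Term n → (k p j a : ℕ) → List (S × ℚ)
    walks [] k p j a = []
    walks (t ∷ ts) k p j a = walk t k p j a ++ walks ts (k + deg t) p (suc j) a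

  -- root: index 1, convention pa(1) = 1, lp(1) = 0, a = arity of decoration of pa(1) = 1
  nodeInfo : Term → List (S × ℚ)
  nodeInfo leaf = []
  nodeInfo (node s ts) = (s , cncVal 1 0 (ar s)) ∷ walks ts 2 1 1 (ar s)

  dc : Term → List S
  dc t = Data.List.map proj₁ (nodeInfo t)

  cnc : Term → List ℚ
  cnc t = Data.List.map proj₂ (nodeInfo t)

  _≼_ : Term → Term → Set
  t₁ ≼ t₂ = (dc t₁ ≡ dc t₂) × Pointwise _≤_ (cnc t₁) (cnc t₂)

  Down : Term → Set
  Down t = Σ Term (λ t' → t ≼ t')

  _≼↓_ : ∀ {t} → Down t → Down t → Set
  x ≼↓ y = proj₁ x ≼ proj₁ y

  _≈↓_ : ∀ {t} → Down t → Down t → Set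
  x ≈↓ y = proj₁ x ≡ proj₁ y

  maxWord : List ℚ → List ℚ → List ℚ
  maxWord = zipWith _⊔_

module Submission where

-- A term is determined by its word of (decoration, connection value) pairs, and the words
-- that arise are exactly those in which the value of every entry is that of a child slot of
-- an earlier node and is smaller than the values of all nodes after the parent of that slot;
-- on such words a decoder inverts the encoding. Both conditions survive the componentwise
-- maximum of two words with equal decorations (the maximum sits in the slot of one of its
-- arguments, and strict inequalities are preserved by ⊔), so the componentwise maximum of the
-- connection words of x, y ∈ ↓t is again the connection word of a term, which is then the
-- join of x and y. As ↓t is finite with least element t, the meet of x and y is the join of
-- their common lower bounds.

open import Defs
open import Algebra.Core using (Op₂)
open import Data.Nat as ℕ using (ℕ; zero; suc; _+_; _∸_; _≤_; _<_; z≤n; s≤s)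
import Data.Nat.Properties as ℕ
import Data.Nat.Coprimality as Coprime
import Data.Integer as ℤ
import Data.Integer.Properties as ℤ
open import Data.Rational as ℚ using (ℚ; _⊔_)
import Data.Rational.Properties as ℚ
open import Data.List using (List; []; _∷_; _++_; [_]; length; map; zipWith; foldr; filter; concatMap; mapMaybe)
import Data.List.Properties as List
open import Data.List.Membership.Propositional using (_∈_)
open import Data.List.Membership.Setoid.Properties using (∈-filter⁺)
open import Data.List.Relation.Unary.All as All using (All; []; _∷_)
import Data.List.Relation.Unary.All.Properties as All
open import Data.List.Relation.Unary.Any as Any using (Any; here; there)
import Data.List.Relation.Unary.Any.Properties as Any
open import Data.List.Relation.Binary.Pointwise as Pointwise using (Pointwise; []; _∷_)
open import Data.Maybe using (Maybe; just; nothing)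
open import Data.Maybe.Properties using (just-injective)
import Data.Maybe.Relation.Unary.Any as Maybe
open import Data.Product using (Σ; ∃; ∃₂; _×_; _,_; proj₁; proj₂; map₁)
import Data.Product.Properties as Product
open import Data.Sum using (_⊎_; inj₁; inj₂)
open import Data.Unit using (⊤; tt)
open import Data.Vec using (Vec; []; _∷_)
open import Function using (_∘_)
open import Relation.Binary using (Rel; IsPartialOrder; Decidable; tri<; tri≈; tri>)
open import Relation.Binary.Definitions using (Minimum)
import Relation.Binary.Construct.On as On
open import Relation.Binary.Lattice.Definitions using (Supremum; Infimum)
open import Relation.Binary.Lattice.Structures using (IsLattice)
open import Relation.Binary.PropositionalEquality
  using (_≡_; _≢_; refl; sym; trans; cong; cong₂; subst; isEquivalence; module ≡-Reasoning)
open import Relation.Nullary using (contradiction; yes; no; _×-dec_)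
import Relation.Nullary.Decidable as Dec

toℚ : ℕ → ℚ
toℚ n = ℤ.+ n ℚ./ 1

toℚ-suc : ∀ n → toℚ (suc n) ≡ toℚ n ℚ.+ ℚ.1ℚ
toℚ-suc n = begin
  ℤ.+ suc n ℚ./ 1
    ≡⟨ cong (λ m → ℤ.+ m ℚ./ 1) (ℕ.+-comm 1 n) ⟩
  (ℤ.+ n ℤ.+ ℤ.+ 1) ℚ./ 1
    ≡⟨ cong (ℚ._/ 1) (cong₂ ℤ._+_ (ℤ.*-identityʳ (ℤ.+ n)) (ℤ.*-identityʳ (ℤ.+ 1))) ⟨
  (ℤ.+ n ℤ.* ℤ.+ 1 ℤ.+ ℤ.+ 1 ℤ.* ℤ.+ 1) ℚ./ 1
    ≡⟨⟩
  ℚ.mkℚ (ℤ.+ n) 0 n⊥1 ℚ.+ ℚ.mkℚ (ℤ.+ 1) 0 1⊥1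
    ≡⟨ cong₂ ℚ._+_ (ℚ.normalize-coprime n⊥1) (ℚ.normalize-coprime 1⊥1) ⟨
  toℚ n ℚ.+ ℚ.1ℚ
    ∎
  where
  open ≡-Reasoning
  n⊥1 = Coprime.sym (Coprime.1-coprimeTo n)
  1⊥1 = Coprime.sym (Coprime.1-coprimeTo 1)

toℚ-suc-1 : ∀ n → toℚ (suc n) ℚ.- ℚ.1ℚ ≡ toℚ n
toℚ-suc-1 n = begin
  toℚ (suc n) ℚ.- ℚ.1ℚ          ≡⟨ cong (ℚ._- ℚ.1ℚ) (toℚ-suc n) ⟩
  toℚ n ℚ.+ ℚ.1ℚ ℚ.- ℚ.1ℚ       ≡⟨ ℚ.+-assoc (toℚ n) ℚ.1ℚ (ℚ.- ℚ.1ℚ) ⟩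
  toℚ n ℚ.+ (ℚ.1ℚ ℚ.- ℚ.1ℚ)     ≡⟨ cong (toℚ n ℚ.+_) (ℚ.+-inverseʳ ℚ.1ℚ) ⟩
  toℚ n ℚ.+ ℚ.0ℚ                ≡⟨ ℚ.+-identityʳ (toℚ n) ⟩
  toℚ n                         ∎
  where open ≡-Reasoning

toℚ-<-suc : ∀ n → toℚ n ℚ.< toℚ (suc n)
toℚ-<-suc n = begin-strict
  toℚ n                ≡⟨ ℚ.+-identityʳ (toℚ n) ⟨
  toℚ n ℚ.+ ℚ.0ℚ       <⟨ ℚ.+-monoʳ-< (toℚ n) (ℚ.positive⁻¹ ℚ.1ℚ) ⟩
  toℚ n ℚ.+ ℚ.1ℚ       ≡⟨ toℚ-suc n ⟨
  toℚ (suc n)          ∎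
  where open ℚ.≤-Reasoning

toℚ-mono-≤ : ∀ {m n} → m ≤ n → toℚ m ℚ.≤ toℚ n
toℚ-mono-≤ = go ∘ ℕ.≤⇒≤′
  where
  go : ∀ {m n} → m ℕ.≤′ n → toℚ m ℚ.≤ toℚ n
  go ℕ.≤′-refl                    = ℚ.≤-refl
  go {n = suc n} (ℕ.≤′-step m≤′n) = ℚ.≤-trans (go m≤′n) (ℚ.<⇒≤ (toℚ-<-suc n))

toℚ-cancel-< : ∀ {m n} → toℚ m ℚ.< toℚ n → m < n
toℚ-cancel-< {m} {n} lt with ℕ.<-≤-connex m n
... | inj₁ m<n = m<n
... | inj₂ n≤m = contradiction (ℚ.<-≤-trans lt (toℚ-mono-≤ {n} {m} n≤m)) (ℚ.<-irrefl refl)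

½<1 : ℚ.½ ℚ.< ℚ.1ℚ
½<1 = ℚ.*<* (ℤ.+<+ (s≤s (s≤s z≤n)))

½*-< : ∀ {x} → ℚ.0ℚ ℚ.< x → ℚ.½ ℚ.* x ℚ.< x
½*-< {x} 0<x = subst (ℚ.½ ℚ.* x ℚ.<_) (ℚ.*-identityˡ x) (ℚ.*-monoˡ-<-pos x {{ℚ.positive 0<x}} ½<1)

½*-pos : ∀ {x} → ℚ.0ℚ ℚ.< x → ℚ.0ℚ ℚ.< ℚ.½ ℚ.* x
½*-pos {x} 0<x = subst (ℚ._< ℚ.½ ℚ.* x) (ℚ.*-zeroʳ ℚ.½) (ℚ.*-monoʳ-<-pos ℚ.½ 0<x)

≤∧≢⇒< : ∀ {p q} → p ℚ.≤ q → p ≢ q → p ℚ.< q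
≤∧≢⇒< {p} {q} p≤q p≢q with p ℚ.<? q
... | yes p<q = p<q
... | no  p≮q = contradiction (ℚ.≤-antisym p≤q (ℚ.≮⇒≥ p≮q)) p≢q

⊔-mono-< : ∀ {p q r s} → p ℚ.< r → q ℚ.< s → p ⊔ q ℚ.< r ⊔ s
⊔-mono-< {p} {q} {r} {s} p<r q<s with ℚ.⊔-sel p q
... | inj₁ p⊔q≡p = subst (ℚ._< r ⊔ s) (sym p⊔q≡p) (ℚ.<-≤-trans p<r (ℚ.p≤p⊔q r s))
... | inj₂ p⊔q≡q = subst (ℚ._< r ⊔ s) (sym p⊔q≡q) (ℚ.<-≤-trans q<s (ℚ.p≤q⊔p r s))

⊔-upperˡ : ∀ {xs ys : List ℚ} → length xs ≡ length ys → Pointwise ℚ._≤_ xs (zipWith _⊔_ xs ys)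
⊔-upperˡ {[]}     {[]}     _  = []
⊔-upperˡ {x ∷ xs} {y ∷ ys} eq = ℚ.p≤p⊔q x y ∷ ⊔-upperˡ (ℕ.suc-injective eq)

⊔-upperʳ : ∀ {xs ys : List ℚ} → length xs ≡ length ys → Pointwise ℚ._≤_ ys (zipWith _⊔_ xs ys)
⊔-upperʳ {[]}     {[]}     _  = []
⊔-upperʳ {x ∷ xs} {y ∷ ys} eq = ℚ.p≤q⊔p x y ∷ ⊔-upperʳ (ℕ.suc-injective eq)

⊔-least : ∀ {xs ys zs : List ℚ} → Pointwise ℚ._≤_ xs zs → Pointwise ℚ._≤_ ys zs →
          Pointwise ℚ._≤_ (zipWith _⊔_ xs ys) zs
⊔-least []            []            = []
⊔-least (x≤z ∷ xs≤zs) (y≤z ∷ ys≤zs) = ℚ.⊔-lub x≤z y≤z ∷ ⊔-least xs≤zs ys≤zs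

m+suc[n]≡o⇒m<o : ∀ {m n o} → m + suc n ≡ o → m < o
m+suc[n]≡o⇒m<o {m} eq = subst (m <_) eq (ℕ.m<m+n m (s≤s z≤n))

map-proj₁-proj₂-injective : ∀ {A B : Set} {xs ys : List (A × B)} →
  map proj₁ xs ≡ map proj₁ ys → map proj₂ xs ≡ map proj₂ ys → xs ≡ ys
map-proj₁-proj₂-injective {xs = []}    {[]}    _   _   = refl
map-proj₁-proj₂-injective {xs = _ ∷ _} {_ ∷ _} eq₁ eq₂ =
  cong₂ _∷_ (Product.×-≡,≡→≡ (List.∷-injectiveˡ eq₁ , List.∷-injectiveˡ eq₂))
            (map-proj₁-proj₂-injective (List.∷-injectiveʳ eq₁) (List.∷-injectiveʳ eq₂))

zipWith-snoc : ∀ {A B C : Set} {R : A → B → Set} (f : A → B → C) {xs ys} x y → Pointwise R xs ys →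
               zipWith f (xs ++ [ x ]) (ys ++ [ y ]) ≡ zipWith f xs ys ++ [ f x y ]
zipWith-snoc f x y []                            = refl
zipWith-snoc f x y (_∷_ {x = x′} {y = y′} _ rs) = cong (f x′ y′ ∷_) (zipWith-snoc f x y rs)

module _ {A : Set} where

  -- positions start at 1, as the internal nodes of a term do
  nth : List A → ℕ → Maybe A
  nth xs       zero          = nothing
  nth []       (suc m)       = nothing
  nth (x ∷ xs) (suc zero)    = just x
  nth (x ∷ xs) (suc (suc m)) = nth xs (suc m)

  nth-++ˡ : ∀ xs ys m {a} → nth xs m ≡ just a → nth (xs ++ ys) m ≡ just a
  nth-++ˡ (x ∷ xs) ys (suc zero)    eq = eq
  nth-++ˡ (x ∷ xs) ys (suc (suc m)) eq = nth-++ˡ xs ys (suc m) eq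

  nth-++⁻ : ∀ xs ys m {a} → nth (xs ++ ys) m ≡ just a → nth xs m ≡ just a ⊎ a ∈ ys
  nth-++⁻ []       (y ∷ ys) (suc zero)    refl = inj₂ (here refl)
  nth-++⁻ []       (y ∷ ys) (suc (suc m)) eq with nth-++⁻ [] ys (suc m) eq
  ... | inj₂ a∈ys = inj₂ (there a∈ys)
  nth-++⁻ (x ∷ xs) ys       (suc zero)    eq = inj₁ eq
  nth-++⁻ (x ∷ xs) ys       (suc (suc m)) eq = nth-++⁻ xs ys (suc m) eq

  nth-snoc : ∀ xs y → nth (xs ++ [ y ]) (suc (length xs)) ≡ just y
  nth-snoc []       y = refl
  nth-snoc (x ∷ xs) y = nth-snoc xs y

  nth-≥1 : ∀ xs m {a} → nth xs m ≡ just a → 1 ≤ m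
  nth-≥1 (x ∷ xs) (suc m) _ = s≤s z≤n

  nth-≤length : ∀ xs m {a} → nth xs m ≡ just a → m ≤ length xs
  nth-≤length (x ∷ xs) (suc zero)    _  = s≤s z≤n
  nth-≤length (x ∷ xs) (suc (suc m)) eq = s≤s (nth-≤length xs (suc m) eq)

  length-snoc : ∀ (xs : List A) y → length (xs ++ [ y ]) ≡ suc (length xs)
  length-snoc []       y = refl
  length-snoc (x ∷ xs) y = cong suc (length-snoc xs y)

nth-Pointwise : ∀ {A B : Set} {R : A → B → Set} {xs ys} m {x} → Pointwise R xs ys → nth xs m ≡ just x →
                ∃ λ y → nth ys m ≡ just y × R x y
nth-Pointwise (suc zero)    (r ∷ _)  refl = _ , refl , r
nth-Pointwise (suc (suc m)) (_ ∷ rs) eq   = nth-Pointwise (suc m) rs eq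

nth-zipWith : ∀ {A B C : Set} (f : A → B → C) xs ys m {z} → nth (zipWith f xs ys) m ≡ just z →
              ∃₂ λ x y → nth xs m ≡ just x × nth ys m ≡ just y × z ≡ f x y
nth-zipWith f (x ∷ xs) (y ∷ ys) (suc zero)    refl = x , y , refl , refl , refl
nth-zipWith f (x ∷ xs) (y ∷ ys) (suc (suc m)) eq   = nth-zipWith f xs ys (suc m) eq

module MeetOfLowerBounds {a ℓ₁ ℓ₂} {A : Set a} {_≈_ : Rel A ℓ₁} {_≤_ : Rel A ℓ₂}
  (isPartialOrder : IsPartialOrder _≈_ _≤_) (_≤?_ : Decidable _≤_)
  {_∨_ : Op₂ A} (supremum : Supremum _≤_ _∨_) {⊥ : A} (⊥-minimum : Minimum _≤_ ⊥)
  (elements : List A) (complete : ∀ x → Any (x ≈_) elements)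
  where

  open IsPartialOrder isPartialOrder using (module Eq; reflexive) renaming (trans to ≤-trans)

  ⨆ : List A → A
  ⨆ = foldr _∨_ ⊥

  ⨆-upper : ∀ {z zs} → Any (z ≈_) zs → z ≤ ⨆ zs
  ⨆-upper {z} {w ∷ ws} (here z≈w)   = ≤-trans (reflexive z≈w) (proj₁ (supremum w (⨆ ws)))
  ⨆-upper {z} {w ∷ ws} (there z∈ws) = ≤-trans (⨆-upper z∈ws) (proj₁ (proj₂ (supremum w (⨆ ws))))

  ⨆-least : ∀ {zs u} → All (_≤ u) zs → ⨆ zs ≤ u
  ⨆-least {[]}     {u} []            = ⊥-minimum u
  ⨆-least {w ∷ ws} {u} (w≤u ∷ ws≤u) = proj₂ (proj₂ (supremum w (⨆ ws))) u w≤u (⨆-least ws≤u)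

  _∧_ : Op₂ A
  x ∧ y = ⨆ (filter (λ z → z ≤? x ×-dec z ≤? y) elements)

  ∧-infimum : Infimum _≤_ _∧_
  ∧-infimum x y = ⨆-least (All.map proj₁ lowerBounds) , ⨆-least (All.map proj₂ lowerBounds) , greatest
    where
    lowerBounds = All.all-filter (λ z → z ≤? x ×-dec z ≤? y) elements
    greatest : ∀ z → z ≤ x → z ≤ y → z ≤ (x ∧ y)
    greatest z z≤x z≤y = ⨆-upper (∈-filter⁺ setoid (λ z → z ≤? x ×-dec z ≤? y)
      (λ z≈w (z≤x , z≤y) → ≤-trans (reflexive (Eq.sym z≈w)) z≤x , ≤-trans (reflexive (Eq.sym z≈w)) z≤y)
      (complete z) (z≤x , z≤y))
      where setoid = record { isEquivalence = IsPartialOrder.isEquivalence isPartialOrder }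

module _ {S : Set} (ar : S → ℕ) where

  pow2inv-pos : ∀ k → ℚ.0ℚ ℚ.< pow2inv ar k
  pow2inv-pos zero    = ℚ.positive⁻¹ ℚ.1ℚ
  pow2inv-pos (suc k) = ½*-pos (pow2inv-pos k)

  pow2inv-≤1 : ∀ k → pow2inv ar k ℚ.≤ ℚ.1ℚ
  pow2inv-≤1 zero    = ℚ.≤-refl
  pow2inv-≤1 (suc k) = ℚ.≤-trans (ℚ.<⇒≤ (½*-< (pow2inv-pos k))) (pow2inv-≤1 k)

  pow2inv-antimono-< : ∀ {k l} → k < l → pow2inv ar l ℚ.< pow2inv ar k
  pow2inv-antimono-< = go ∘ ℕ.≤⇒≤′
    where
    go : ∀ {k l} → suc k ℕ.≤′ l → pow2inv ar l ℚ.< pow2inv ar k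
    go {k} ℕ.≤′-refl                = ½*-< (pow2inv-pos k)
    go {l = suc l} (ℕ.≤′-step k<′l) = ℚ.<-trans (½*-< (pow2inv-pos l)) (go k<′l)

  pow2inv-antimono-≤ : ∀ {k l} → k ≤ l → pow2inv ar l ℚ.≤ pow2inv ar k
  pow2inv-antimono-≤ k≤l with ℕ.m≤n⇒m<n∨m≡n k≤l
  ... | inj₁ k<l  = ℚ.<⇒≤ (pow2inv-antimono-< k<l)
  ... | inj₂ refl = ℚ.≤-refl

  cncVal-<-suc : ∀ p j a → cncVal ar p j a ℚ.< toℚ (suc p)
  cncVal-<-suc p j a = begin-strict
    toℚ (suc p) ℚ.- pow2inv ar (a ∸ j) <⟨ ℚ.+-monoʳ-< (toℚ (suc p)) (ℚ.neg-antimono-< (pow2inv-pos (a ∸ j))) ⟩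
    toℚ (suc p) ℚ.+ ℚ.0ℚ               ≡⟨ ℚ.+-identityʳ (toℚ (suc p)) ⟩
    toℚ (suc p)                        ∎
    where open ℚ.≤-Reasoning

  toℚ-≤-cncVal : ∀ p j a → toℚ p ℚ.≤ cncVal ar p j a
  toℚ-≤-cncVal p j a = begin
    toℚ p                              ≡⟨ toℚ-suc-1 p ⟨
    toℚ (suc p) ℚ.- ℚ.1ℚ               ≤⟨ ℚ.+-monoʳ-≤ (toℚ (suc p)) (ℚ.neg-antimono-≤ (pow2inv-≤1 (a ∸ j))) ⟩
    toℚ (suc p) ℚ.- pow2inv ar (a ∸ j) ∎
    where open ℚ.≤-Reasoning

  cncVal-last : ∀ p j a → a ≤ j → cncVal ar p j a ≡ toℚ p
  cncVal-last p j a a≤j = trans (cong (λ k → toℚ (suc p) ℚ.- pow2inv ar k) (ℕ.m≤n⇒m∸n≡0 a≤j)) (toℚ-suc-1 p)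

  cncVal-antimono-≤ : ∀ p a {j j′} → j ≤ j′ → cncVal ar p j′ a ℚ.≤ cncVal ar p j a
  cncVal-antimono-≤ p a j≤j′ =
    ℚ.+-monoʳ-≤ (toℚ (suc p)) (ℚ.neg-antimono-≤ (pow2inv-antimono-≤ (ℕ.∸-monoʳ-≤ a j≤j′)))

  cncVal-antimono-< : ∀ p a {j j′} → j < j′ → j′ ≤ a → cncVal ar p j′ a ℚ.< cncVal ar p j a
  cncVal-antimono-< p a j<j′ j′≤a =
    ℚ.+-monoʳ-< (toℚ (suc p)) (ℚ.neg-antimono-< (pow2inv-antimono-< (ℕ.∸-monoʳ-< j<j′ j′≤a)))

  cncVal-<-toℚ : ∀ p j a {m} → p < m → cncVal ar p j a ℚ.< toℚ m
  cncVal-<-toℚ p j a p<m = ℚ.<-≤-trans (cncVal-<-suc p j a) (toℚ-mono-≤ p<m)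

  cncVal-<-toℚ⁻ : ∀ p j a {m} → cncVal ar p j a ℚ.< toℚ m → p < m
  cncVal-<-toℚ⁻ p j a lt = toℚ-cancel-< (ℚ.≤-<-trans (toℚ-≤-cncVal p j a) lt)

  cncVal-mono-< : ∀ p j a p′ j′ a′ → p < p′ → cncVal ar p j a ℚ.< cncVal ar p′ j′ a′
  cncVal-mono-< p j a p′ j′ a′ p<p′ = ℚ.<-≤-trans (cncVal-<-toℚ p j a p<p′) (toℚ-≤-cncVal p′ j′ a′)

  Entry : Set
  Entry = S × ℚ

  Word : Set
  Word = List Entry

  arity : Entry → ℕ
  arity e = ar (proj₁ e)

  record Slot (P : Word) (c : ℚ) : Set where
    constructor slot
    field
      parent position   : ℕ
      {parentEntry}     : Entry
      parent-at         : nth P parent ≡ just parentEntry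
      1≤position        : 1 ≤ position
      position≤arity    : position ≤ arity parentEntry
      value             : c ≡ cncVal ar parent position (arity parentEntry)

  -- As cncVal p j a lies in [p, p + 1), c ℚ.< toℚ m says that node m comes after the parent of the slot with value c.
  LaterNodesAbove : Word → ℚ → Set
  LaterNodesAbove P c = ∀ m {e} → nth P m ≡ just e → c ℚ.< toℚ m → c ℚ.< proj₂ e

  Admissible : Word → Entry → Set
  Admissible P e = Slot P (proj₂ e) × LaterNodesAbove P (proj₂ e)

  data ValidAfter : Word → Word → Set where
    []  : ∀ {P} → ValidAfter P []
    _∷_ : ∀ {P e L} → Admissible P e → ValidAfter (P ++ [ e ]) L → ValidAfter P (e ∷ L)

  root : S → Entry
  root s = s , cncVal ar 1 0 (ar s)

  data Valid : Word → Set where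
    empty  : Valid []
    rooted : ∀ s {L} → ValidAfter [ root s ] L → Valid (root s ∷ L)

  ValidAfter-++ : ∀ {P} A {B} → ValidAfter P A → ValidAfter (P ++ A) B → ValidAfter P (A ++ B)
  ValidAfter-++ {P} []      _        vB = subst (λ Q → ValidAfter Q _) (List.++-identityʳ P) vB
  ValidAfter-++ {P} (e ∷ A) (ok ∷ vA) vB =
    ok ∷ ValidAfter-++ A vA (subst (λ Q → ValidAfter Q _) (sym (List.++-assoc P [ e ] A)) vB)

  ValidAfter-split : ∀ {P} A {B} → ValidAfter P (A ++ B) → ValidAfter P A × ValidAfter (P ++ A) B
  ValidAfter-split {P} []      v        = [] , subst (λ Q → ValidAfter Q _) (sym (List.++-identityʳ P)) v
  ValidAfter-split {P} (e ∷ A) (ok ∷ v) with ValidAfter-split A v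
  ... | vA , vB = ok ∷ vA , subst (λ Q → ValidAfter Q _) (List.++-assoc P [ e ] A) vB

  length-walk : ∀ u k p j a → length (walk ar u k p j a) ≡ deg ar u
  length-walks : ∀ {n} (ts : Vec (Term ar) n) k p j a → length (walks ar ts k p j a) ≡ degs ar ts
  length-walk leaf        k p j a = refl
  length-walk (node s ts) k p j a = cong suc (length-walks ts (suc k) k 1 (ar s))
  length-walks []       k p j a = refl
  length-walks (t ∷ ts) k p j a = trans (List.length-++ (walk ar t k p j a))
    (cong₂ _+_ (length-walk t k p j a) (length-walks ts (k + deg ar t) p (suc j) a))

  length-++-walk : ∀ P u {k p j a} → suc (length (P ++ walk ar u k p j a)) ≡ suc (length P) + deg ar u
  length-++-walk P u {k} {p} {j} {a} = cong suc (trans (List.length-++ P) (cong (length P +_) (length-walk u k p j a)))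

  fresh-laterNodesAbove : ∀ P {p} j a → length P ≤ p → LaterNodesAbove P (cncVal ar p j a)
  fresh-laterNodesAbove P j a |P|≤p m nth≡ c<m =
    contradiction (ℕ.≤-trans (nth-≤length P m nth≡) |P|≤p) (ℕ.<⇒≱ (cncVal-<-toℚ⁻ _ j a {m} c<m))

  walk-valid : ∀ u {P k p j e} → suc (length P) ≡ k → nth P p ≡ just e → 1 ≤ j → j ≤ arity e →
    LaterNodesAbove P (cncVal ar p j (arity e)) →
    ValidAfter P (walk ar u k p j (arity e)) ×
    All (λ x → cncVal ar p j (arity e) ℚ.≤ proj₂ x) (walk ar u k p j (arity e))
  walks-valid : ∀ {n} (ts : Vec (Term ar) n) {P k p i e} → suc (length P) ≡ k → nth P p ≡ just e → i + n ≡ arity e →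
    (i < arity e → LaterNodesAbove P (cncVal ar p (suc i) (arity e))) →
    ValidAfter P (walks ar ts k p (suc i) (arity e)) ×
    All (λ x → toℚ p ℚ.≤ proj₂ x) (walks ar ts k p (suc i) (arity e))

  walk-valid leaf _ _ _ _ _ = [] , []
  walk-valid (node s ts) {P} {p = p} {j} {e} refl p∈P 1≤j j≤a above =
    (((slot p j p∈P 1≤j j≤a refl) , above) ∷ proj₁ children) ,
    (ℚ.≤-refl ∷ All.map (λ k≤v → ℚ.<⇒≤ (ℚ.<-≤-trans c<k k≤v)) (proj₂ children))
    where
    k = suc (length P)
    x = s , cncVal ar p j (arity e)
    c<k : cncVal ar p j (arity e) ℚ.< toℚ k
    c<k = cncVal-<-toℚ p j (arity e) (s≤s (nth-≤length P p p∈P))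
    children = walks-valid ts {P ++ [ x ]} {suc k} {k} {0} {x} (cong suc (length-snoc P x)) (nth-snoc P x) refl
                 (λ _ → fresh-laterNodesAbove (P ++ [ x ]) 1 (ar s) (ℕ.≤-reflexive (length-snoc P x)))

  walks-valid []       _ _ _ _ = [] , []
  walks-valid {suc n} (t ∷ ts) {P} {k} {p} {i} {e} refl p∈P i+n≡a above =
    ValidAfter-++ (walk ar t k p (suc i) a) (proj₁ first) (proj₁ rest) ,
    All.++⁺ (All.map (ℚ.≤-trans (toℚ-≤-cncVal p (suc i) a)) (proj₂ first)) (proj₂ rest)
    where
    a = arity e
    i<a = m+suc[n]≡o⇒m<o i+n≡a
    first = walk-valid t refl p∈P (s≤s z≤n) i<a (above i<a)
    above′ : suc i < a → LaterNodesAbove (P ++ walk ar t k p (suc i) a) (cncVal ar p (suc (suc i)) a)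
    above′ si<a m nth≡ c<m with nth-++⁻ P (walk ar t k p (suc i) a) m nth≡
    ... | inj₁ inP = ℚ.≤-<-trans (cncVal-antimono-≤ p a (ℕ.n≤1+n (suc i)))
                       (above i<a m inP (cncVal-<-toℚ p (suc i) a (cncVal-<-toℚ⁻ p (suc (suc i)) a {m} c<m)))
    ... | inj₂ inT = ℚ.<-≤-trans (cncVal-antimono-< p a (ℕ.n<1+n (suc i)) si<a) (All.lookup (proj₂ first) inT)
    rest = walks-valid ts {P ++ walk ar t k p (suc i) a} {k + deg ar t} {p} {suc i} {e}
             (length-++-walk P t) (nth-++ˡ P _ p p∈P) (trans (sym (ℕ.+-suc i n)) i+n≡a) above′

  nodeInfo-valid : ∀ u → Valid (nodeInfo ar u)
  nodeInfo-valid leaf        = empty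
  nodeInfo-valid (node s ts) = rooted s (proj₁ (walks-valid ts {[ root s ]} {2} {1} {0} refl refl refl
                                 (λ _ → fresh-laterNodesAbove [ root s ] 1 (ar s) ℕ.≤-refl)))

  Head : (ℚ → Set) → Word → Set
  Head P []      = ⊤
  Head P (e ∷ _) = P (proj₂ e)

  Head-<-mono : ∀ {x y} R → x ℚ.≤ y → Head (ℚ._< x) R → Head (ℚ._< y) R
  Head-<-mono []      x≤y _   = tt
  Head-<-mono (_ ∷ _) x≤y v<x = ℚ.<-≤-trans v<x x≤y

  -- The fuel f bounds the nesting depth; the length of the word is always enough.
  decodeTerm : ℕ → (k p j a : ℕ) → Word → Term ar × Word
  decodeTerms : ℕ → (k p j a n : ℕ) → Word → Vec (Term ar) n × Word

  decodeTerm zero    k p j a R = leaf , R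
  decodeTerm (suc f) k p j a [] = leaf , []
  decodeTerm (suc f) k p j a ((s , c) ∷ R) with c ℚ.≟ cncVal ar p j a
  ... | yes _ = map₁ (node s) (decodeTerms f (suc k) k 1 (ar s) (ar s) R)
  ... | no _  = leaf , (s , c) ∷ R

  decodeTerms f k p j a zero    R = [] , R
  decodeTerms f k p j a (suc n) R with decodeTerm f k p j a R
  ... | t , R₁ = map₁ (t ∷_) (decodeTerms f (k + deg ar t) p (suc j) a n R₁)

  decode : Word → Term ar
  decode []            = leaf
  decode ((s , _) ∷ R) = node s (proj₁ (decodeTerms (length R) 2 1 1 (ar s) (ar s) R))

  head-walks : ∀ {n} (ts : Vec (Term ar) n) {k p i a} R → i + n ≡ a → Head (ℚ._< toℚ p) R →
               Head (ℚ._< cncVal ar p i a) (walks ar ts k p (suc i) a ++ R)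
  head-walks [] {p = p} {i} {a} R _ R<p = Head-<-mono R (toℚ-≤-cncVal p i a) R<p
  head-walks {suc n} (leaf ∷ ts) {k} {p} {i} {a} R i+n≡a R<p =
    Head-<-mono (walks ar ts (k + 0) p (suc (suc i)) a ++ R) (cncVal-antimono-≤ p a (ℕ.n≤1+n i))
      (head-walks ts R (trans (sym (ℕ.+-suc i n)) i+n≡a) R<p)
  head-walks (node s us ∷ ts) {p = p} {i} {a} R i+n≡a R<p =
    cncVal-antimono-< p a (ℕ.n<1+n i) (m+suc[n]≡o⇒m<o i+n≡a)

  decodeTerm-walk : ∀ u {f k p j a} R → deg ar u ≤ f → p < k → Head (ℚ._< cncVal ar p j a) R →
                decodeTerm f k p j a (walk ar u k p j a ++ R) ≡ (u , R)
  decodeTerms-walks : ∀ {n} (ts : Vec (Term ar) n) {f k p i a} R → degs ar ts ≤ f → p < k → i + n ≡ a →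
                 Head (ℚ._< toℚ p) R → decodeTerms f k p (suc i) a n (walks ar ts k p (suc i) a ++ R) ≡ (ts , R)

  decodeTerm-walk leaf {zero}  R              _ _ _   = refl
  decodeTerm-walk leaf {suc f} []             _ _ _   = refl
  decodeTerm-walk leaf {suc f} {p = p} {j} {a} ((s , c) ∷ R) _ _ c<v with c ℚ.≟ cncVal ar p j a
  ... | yes c≡v = contradiction c≡v (ℚ.<⇒≢ c<v)
  ... | no  _   = refl
  decodeTerm-walk (node s ts) {suc f} {k} {p} {j} {a} R (s≤s degs≤f) p<k R<v
    with cncVal ar p j a ℚ.≟ cncVal ar p j a
  ... | yes _  = cong (map₁ (node s)) (decodeTerms-walks ts R degs≤f (ℕ.n<1+n k) refl
                   (Head-<-mono R (ℚ.<⇒≤ (cncVal-<-toℚ p j a p<k)) R<v))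
  ... | no v≢v = contradiction refl v≢v

  decodeTerms-walks []       R _ _ _ _ = refl
  decodeTerms-walks {suc n} (t ∷ ts) {f} {k} {p} {i} {a} R degs≤f p<k i+n≡a R<p
    rewrite List.++-assoc (walk ar t k p (suc i) a) (walks ar ts (k + deg ar t) p (suc (suc i)) a) R
          | decodeTerm-walk t {f} {k} {p} {suc i} {a} (walks ar ts (k + deg ar t) p (suc (suc i)) a ++ R)
              (ℕ.≤-trans (ℕ.m≤m+n (deg ar t) (degs ar ts)) degs≤f) p<k
              (head-walks ts R (trans (sym (ℕ.+-suc i n)) i+n≡a) R<p)
    = cong (map₁ (t ∷_)) (decodeTerms-walks ts R (ℕ.≤-trans (ℕ.m≤n+m (degs ar ts) (deg ar t)) degs≤f)
        (ℕ.≤-trans p<k (ℕ.m≤m+n k (deg ar t))) (trans (sym (ℕ.+-suc i n)) i+n≡a) R<p)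

  decode-nodeInfo : ∀ u → decode (nodeInfo ar u) ≡ u
  decode-nodeInfo leaf        = refl
  decode-nodeInfo (node s ts) = cong (node s ∘ proj₁) (begin
    decodeTerms (length W) 2 1 1 (ar s) (ar s) W
      ≡⟨ cong (decodeTerms (length W) 2 1 1 (ar s) (ar s)) (List.++-identityʳ W) ⟨
    decodeTerms (length W) 2 1 1 (ar s) (ar s) (W ++ [])
      ≡⟨ decodeTerms-walks ts [] (ℕ.≤-reflexive (sym (length-walks ts 2 1 1 (ar s)))) (s≤s (s≤s z≤n)) refl tt ⟩
    (ts , [])
      ∎)
    where
    open ≡-Reasoning
    W = walks ar ts 2 1 1 (ar s)

  nodeInfo-injective : ∀ {u v} → nodeInfo ar u ≡ nodeInfo ar v → u ≡ v
  nodeInfo-injective {u} {v} eq = trans (sym (decode-nodeInfo u)) (trans (cong decode eq) (decode-nodeInfo v))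

  ≼-isPartialOrder : IsPartialOrder _≡_ (_≼_ ar)
  ≼-isPartialOrder = record
    { isPreorder = record
      { isEquivalence = isEquivalence
      ; reflexive     = λ { refl → refl , Pointwise.refl ℚ.≤-refl }
      ; trans         = λ (dc≡ , ≤₁) (dc≡′ , ≤₂) → trans dc≡ dc≡′ , Pointwise.transitive ℚ.≤-trans ≤₁ ≤₂
      }
    ; antisym = λ (dc≡ , ≤₁) (_ , ≤₂) → nodeInfo-injective
        (map-proj₁-proj₂-injective dc≡ (Pointwise.Pointwise-≡⇒≡ (Pointwise.antisymmetric ℚ.≤-antisym ≤₁ ≤₂)))
    }

  slot-<-fresh : ∀ P x {c} → Slot (P ++ [ x ]) c → c ℚ.< cncVal ar (suc (length P)) 0 (arity x)
  slot-<-fresh P x (slot q j q∈ 1≤j j≤a refl)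
    with ℕ.m≤n⇒m<n∨m≡n (subst (q ≤_) (length-snoc P x) (nth-≤length (P ++ [ x ]) q q∈))
  ... | inj₁ q<k  =
    ℚ.<-≤-trans (cncVal-<-toℚ q j _ {suc (length P)} q<k) (toℚ-≤-cncVal (suc (length P)) 0 (arity x))
  ... | inj₂ refl with just-injective (trans (sym q∈) (nth-snoc P x))
  ...   | refl = cncVal-antimono-< q (arity x) 1≤j j≤a

  slot-next : ∀ {P} p {e i c} → nth P p ≡ just e → i < arity e → Slot P c →
              c ℚ.< cncVal ar p i (arity e) → c ℚ.≤ cncVal ar p (suc i) (arity e)
  slot-next p {e} {i} p∈P i<a (slot q j q∈P _ _ refl) c<v with ℕ.<-cmp q p
  ... | tri< q<p _ _ = ℚ.<⇒≤ (ℚ.<-≤-trans (cncVal-<-toℚ q j _ q<p) (toℚ-≤-cncVal p (suc i) (arity e)))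
  ... | tri> _ _ p<q = contradiction (ℚ.<-trans c<v (cncVal-mono-< p i _ q j _ p<q)) (ℚ.<-irrefl refl)
  ... | tri≈ _ refl _ with just-injective (trans (sym q∈P) p∈P)
  ...   | refl with ℕ.≤-<-connex j i
  ...     | inj₁ j≤i = contradiction (ℚ.<-≤-trans c<v (cncVal-antimono-≤ p (arity e) j≤i)) (ℚ.<-irrefl refl)
  ...     | inj₂ i<j = cncVal-antimono-≤ p (arity e) i<j

  toℚ1-≤-slot : ∀ {P c} → Slot P c → toℚ 1 ℚ.≤ c
  toℚ1-≤-slot {P} (slot q j q∈P _ _ refl) = ℚ.≤-trans (toℚ-mono-≤ (nth-≥1 P q q∈P)) (toℚ-≤-cncVal q j _)

  head-after-subtree : ∀ {P k x} W R → nth P k ≡ just x → ValidAfter P (W ++ R) →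
                       Head (ℚ._< toℚ k) R → Head (ℚ._< proj₂ x) R
  head-after-subtree W [] _ _ _ = tt
  head-after-subtree {P} {k} W (e ∷ R) k∈P v e<k with ValidAfter-split W v
  ... | _ , (_ , above) ∷ _ = above k (nth-++ˡ P W k k∈P) e<k

  head-below-fresh : ∀ P x {R} → ValidAfter (P ++ [ x ]) R → Head (ℚ._< cncVal ar (suc (length P)) 0 (arity x)) R
  head-below-fresh P x []                 = tt
  head-below-fresh P x ((slot′ , _) ∷ _) = slot-<-fresh P x slot′

  head-next : ∀ {P} p {e i R} → nth P p ≡ just e → i < arity e → ValidAfter P R →
              Head (ℚ._< cncVal ar p i (arity e)) R → Head (ℚ._≤ cncVal ar p (suc i) (arity e)) R
  head-next p p∈P i<a []                 _   = tt
  head-next p p∈P i<a ((slot′ , _) ∷ _) c<v = slot-next p p∈P i<a slot′ c<v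

  walk-decodeTerm : ∀ f {P k p j e} R → suc (length P) ≡ k → nth P p ≡ just e → ValidAfter P R →
    Head (ℚ._≤ cncVal ar p j (arity e)) R → length R ≤ f →
    let (u , R′) = decodeTerm f k p j (arity e) R in
    walk ar u k p j (arity e) ++ R′ ≡ R × Head (ℚ._< cncVal ar p j (arity e)) R′
  walks-decodeTerms : ∀ f n {P k p i e} R → suc (length P) ≡ k → nth P p ≡ just e → i + n ≡ arity e → ValidAfter P R →
    Head (ℚ._< cncVal ar p i (arity e)) R → length R ≤ f →
    let (ts , R′) = decodeTerms f k p (suc i) (arity e) n R in
    walks ar ts k p (suc i) (arity e) ++ R′ ≡ R × Head (ℚ._< toℚ p) R′

  walk-decodeTerm zero    []            _ _ _ _ _ = refl , tt
  walk-decodeTerm (suc f) []            _ _ _ _ _ = refl , tt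
  walk-decodeTerm (suc f) {P} {p = p} {j} {e} ((s , c) ∷ R) refl p∈P (_ ∷ v) c≤v (s≤s |R|≤f)
    with c ℚ.≟ cncVal ar p j (arity e)
  ... | no  c≢v  = refl , ≤∧≢⇒< c≤v c≢v
  ... | yes refl = cong (x ∷_) (proj₁ children) ,
    head-after-subtree {k = k} W R′ (nth-snoc P x) (subst (ValidAfter _) (sym (proj₁ children)) v) (proj₂ children)
    where
    x = s , c
    k = suc (length P)
    children = walks-decodeTerms f (ar s) {P ++ [ x ]} {suc k} {k} {0} {x} R (cong suc (length-snoc P x))
                 (nth-snoc P x) refl v (head-below-fresh P x v) |R|≤f
    W = walks ar (proj₁ (decodeTerms f (suc k) k 1 (ar s) (ar s) R)) (suc k) k 1 (ar s)
    R′ = proj₂ (decodeTerms f (suc k) k 1 (ar s) (ar s) R)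

  walks-decodeTerms f zero {p = p} {i} {e} R _ _ i+0≡a _ R<v _ =
    refl , subst (λ v → Head (ℚ._< v) R) (cncVal-last p i a (ℕ.≤-reflexive (trans (sym i+0≡a) (ℕ.+-identityʳ i)))) R<v
    where a = arity e
  walks-decodeTerms f (suc n) {P} {p = p} {i} {e} R refl p∈P i+n≡a v R<v |R|≤f
    with decodeTerm f (suc (length P)) p (suc i) (arity e) R
       | walk-decodeTerm f {P} {suc (length P)} {p} {suc i} {e} R refl p∈P v
           (head-next p p∈P (m+suc[n]≡o⇒m<o i+n≡a) v R<v) |R|≤f
  ... | t , R₁ | walkEq , R₁<v =
    (begin
      (W ++ Ws) ++ R₂ ≡⟨ List.++-assoc W Ws R₂ ⟩
      W ++ (Ws ++ R₂) ≡⟨ cong (W ++_) (proj₁ rest) ⟩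
      W ++ R₁         ≡⟨ walkEq ⟩
      R               ∎) ,
    proj₂ rest
    where
    open ≡-Reasoning
    a = arity e
    W = walk ar t (suc (length P)) p (suc i) a
    v₁ = proj₂ (ValidAfter-split W (subst (ValidAfter P) (sym walkEq) v))
    |R₁|≤f : length R₁ ≤ f
    |R₁|≤f = ℕ.≤-trans (subst (length R₁ ≤_) (trans (sym (List.length-++ W)) (cong length walkEq)) (ℕ.m≤n+m _ _))
               |R|≤f
    k′ = suc (length P) + deg ar t
    rest = walks-decodeTerms f n {P ++ W} {k′} {p} {suc i} {e} R₁ (length-++-walk P t) (nth-++ˡ P W p p∈P)
             (trans (sym (ℕ.+-suc i n)) i+n≡a) v₁ R₁<v |R₁|≤f
    Ws = walks ar (proj₁ (decodeTerms f k′ p (suc (suc i)) a n R₁)) k′ p (suc (suc i)) a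
    R₂ = proj₂ (decodeTerms f k′ p (suc (suc i)) a n R₁)

  nothing-after-root : ∀ {P R} → ValidAfter P R → Head (ℚ._< toℚ 1) R → R ≡ []
  nothing-after-root []                c<1 = refl
  nothing-after-root ((slot′ , _) ∷ _) c<1 = contradiction (ℚ.<-≤-trans c<1 (toℚ1-≤-slot slot′)) (ℚ.<-irrefl refl)

  nodeInfo-decode : ∀ {W} → Valid W → nodeInfo ar (decode W) ≡ W
  nodeInfo-decode empty = refl
  nodeInfo-decode (rooted s {L} v) = cong (root s ∷_) (begin
    Ws        ≡⟨ List.++-identityʳ Ws ⟨
    Ws ++ []  ≡⟨ cong (Ws ++_) (nothing-after-root (proj₂ (ValidAfter-split Ws v′)) (proj₂ children)) ⟨
    Ws ++ R′  ≡⟨ proj₁ children ⟩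
    L         ∎)
    where
    open ≡-Reasoning
    children = walks-decodeTerms (length L) (ar s) {[ root s ]} {2} {1} {0} L refl refl refl v
                 (head-below-fresh [] (root s) v) ℕ.≤-refl
    Ws = walks ar (proj₁ (decodeTerms (length L) 2 1 1 (ar s) (ar s) L)) 2 1 1 (ar s)
    R′ = proj₂ (decodeTerms (length L) 2 1 1 (ar s) (ar s) L)
    v′ = subst (ValidAfter _) (sym (proj₁ children)) v

  mergeEntry : Entry → Entry → Entry
  mergeEntry a b = proj₁ a , proj₂ a ⊔ proj₂ b

  merge : Word → Word → Word
  merge = zipWith mergeEntry

  SameDecorations : Word → Word → Set
  SameDecorations = Pointwise (λ a b → proj₁ a ≡ proj₁ b)

  sameDecorations-mergeˡ : ∀ {A B} → SameDecorations A B → SameDecorations A (merge A B)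
  sameDecorations-mergeˡ []       = []
  sameDecorations-mergeˡ (_ ∷ rs) = refl ∷ sameDecorations-mergeˡ rs

  sameDecorations-mergeʳ : ∀ {A B} → SameDecorations A B → SameDecorations B (merge A B)
  sameDecorations-mergeʳ []       = []
  sameDecorations-mergeʳ (r ∷ rs) = sym r ∷ sameDecorations-mergeʳ rs

  slot-transport : ∀ {P Q c} → SameDecorations P Q → Slot P c → Slot Q c
  slot-transport P≈Q (slot q j q∈P 1≤j j≤a refl) with nth-Pointwise q P≈Q q∈P
  ... | _ , q∈Q , s≡s′ = slot q j q∈Q 1≤j (subst (λ s → j ℕ.≤ ar s) s≡s′ j≤a) (cong (λ s → cncVal ar q j (ar s)) s≡s′)

  admissible-merge : ∀ {P Q a b} → SameDecorations P Q → Admissible P a → Admissible Q b →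
                     Admissible (merge P Q) (mergeEntry a b)
  admissible-merge {P} {Q} {a} {b} P≈Q (slotP , aboveP) (slotQ , aboveQ) = slot′ , above′
    where
    slot′ : Slot (merge P Q) (proj₂ a ⊔ proj₂ b)
    slot′ with ℚ.⊔-sel (proj₂ a) (proj₂ b)
    ... | inj₁ eq = subst (Slot _) (sym eq) (slot-transport (sameDecorations-mergeˡ P≈Q) slotP)
    ... | inj₂ eq = subst (Slot _) (sym eq) (slot-transport (sameDecorations-mergeʳ P≈Q) slotQ)
    above′ : LaterNodesAbove (merge P Q) (proj₂ a ⊔ proj₂ b)
    above′ m m∈PQ c<m with nth-zipWith mergeEntry P Q m m∈PQ
    ... | x , y , m∈P , m∈Q , refl =
      ⊔-mono-< (aboveP m m∈P (ℚ.≤-<-trans (ℚ.p≤p⊔q (proj₂ a) (proj₂ b)) c<m))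
               (aboveQ m m∈Q (ℚ.≤-<-trans (ℚ.p≤q⊔p (proj₂ a) (proj₂ b)) c<m))

  validAfter-merge : ∀ {P Q A B} → SameDecorations P Q → SameDecorations A B →
                     ValidAfter P A → ValidAfter Q B → ValidAfter (merge P Q) (merge A B)
  validAfter-merge _   []       []        []        = []
  validAfter-merge {P} {Q} P≈Q (_∷_ {x = a} {y = b} a≈b A≈B) (okA ∷ vA) (okB ∷ vB) =
    admissible-merge {a = a} {b} P≈Q okA okB ∷
    subst (λ M → ValidAfter M _) (zipWith-snoc mergeEntry a b P≈Q)
      (validAfter-merge (Pointwise.++⁺ P≈Q (a≈b ∷ [])) A≈B vA vB)

  merge-root : ∀ s → mergeEntry (root s) (root s) ≡ root s
  merge-root s = cong (s ,_) (ℚ.⊔-idem (cncVal ar 1 0 (ar s)))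

  valid-merge : ∀ {A B} → SameDecorations A B → Valid A → Valid B → Valid (merge A B)
  valid-merge []           empty         empty          = empty
  valid-merge (refl ∷ A≈B) (rooted s {A} vA) (rooted .s {B} vB) =
    subst (λ r → Valid (r ∷ merge A B)) (sym (merge-root s))
      (rooted s (subst (λ P → ValidAfter P (merge A B)) (cong [_] (merge-root s))
        (validAfter-merge (refl ∷ []) A≈B vA vB)))

  map-proj₁-merge : ∀ {A B} → SameDecorations A B → map proj₁ (merge A B) ≡ map proj₁ A
  map-proj₁-merge []       = refl
  map-proj₁-merge (_ ∷ rs) = cong (_ ∷_) (map-proj₁-merge rs)

  map-proj₂-merge : ∀ A B → map proj₂ (merge A B) ≡ zipWith _⊔_ (map proj₂ A) (map proj₂ B)
  map-proj₂-merge []      _       = refl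
  map-proj₂-merge (_ ∷ _) []      = refl
  map-proj₂-merge (a ∷ A) (b ∷ B) = cong (_ ∷_) (map-proj₂-merge A B)

  decorations : Term ar → List S
  decorationsⱽ : ∀ {n} → Vec (Term ar) n → List S
  decorations leaf        = []
  decorations (node s ts) = s ∷ decorationsⱽ ts
  decorationsⱽ []       = []
  decorationsⱽ (t ∷ ts) = decorations t ++ decorationsⱽ ts

  decorations-walk : ∀ u k p j a → map proj₁ (walk ar u k p j a) ≡ decorations u
  decorations-walks : ∀ {n} (ts : Vec (Term ar) n) k p j a → map proj₁ (walks ar ts k p j a) ≡ decorationsⱽ ts
  decorations-walk leaf        k p j a = refl
  decorations-walk (node s ts) k p j a = cong (s ∷_) (decorations-walks ts (suc k) k 1 (ar s))
  decorations-walks []       k p j a = refl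
  decorations-walks (t ∷ ts) k p j a =
    trans (List.map-++ proj₁ (walk ar t k p j a) _)
          (cong₂ _++_ (decorations-walk t k p j a) (decorations-walks ts (k + deg ar t) p (suc j) a))

  dc-decorations : ∀ u → dc ar u ≡ decorations u
  dc-decorations leaf        = refl
  dc-decorations (node s ts) = cong (s ∷_) (decorations-walks ts 2 1 1 (ar s))

  length-nodeInfo : ∀ u → length (nodeInfo ar u) ≡ deg ar u
  length-nodeInfo leaf        = refl
  length-nodeInfo (node s ts) = cong suc (length-walks ts 2 1 1 (ar s))

  record Parse (w : List S) : Set where
    constructor parse
    field
      term   : Term ar
      rest   : List S
      splits : decorations term ++ rest ≡ w

  record Parseⱽ (n : ℕ) (w : List S) : Set where
    constructor parseⱽ
    field
      terms  : Vec (Term ar) n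
      rest   : List S
      splits : decorationsⱽ terms ++ rest ≡ w

  open Parse
  open Parseⱽ

  node-parse : ∀ s {w} → Parseⱽ (ar s) w → Parse (s ∷ w)
  node-parse s (parseⱽ ts r eq) = parse (node s ts) r (cong (s ∷_) eq)

  cons-parse : ∀ {n w} (π : Parse w) → Parseⱽ n (rest π) → Parseⱽ (suc n) w
  cons-parse (parse t r eq) (parseⱽ ts r′ eq′) =
    parseⱽ (t ∷ ts) r′
      (trans (List.++-assoc (decorations t) (decorationsⱽ ts) r′) (trans (cong (decorations t ++_) eq′) eq))

  parses : ℕ → (w : List S) → List (Parse w)
  node-parses : ℕ → (w : List S) → List (Parse w)
  parsesⱽ : ℕ → (n : ℕ) (w : List S) → List (Parseⱽ n w)
  parses f w = parse leaf w refl ∷ node-parses f w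
  node-parses zero    w       = []
  node-parses (suc f) []      = []
  node-parses (suc f) (s ∷ w) = map (node-parse s) (parsesⱽ f (ar s) w)
  parsesⱽ f zero    w = [ parseⱽ [] w refl ]
  parsesⱽ f (suc n) w = concatMap (λ π → map (cons-parse π) (parsesⱽ f n (rest π))) (parses f w)

  parses-complete : ∀ f u r {w} → decorations u ++ r ≡ w → deg ar u ≤ f →
                    Any (λ π → term π ≡ u × rest π ≡ r) (parses f w)
  parsesⱽ-complete : ∀ f {n} (ts : Vec (Term ar) n) r {w} → decorationsⱽ ts ++ r ≡ w → degs ar ts ≤ f →
                     Any (λ π → terms π ≡ ts × rest π ≡ r) (parsesⱽ f n w)
  parses-complete f       leaf        r eq   _             = here (refl , sym eq)
  parses-complete (suc f) (node s ts) r refl (s≤s degs≤f) =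
    there (Any.gmap (λ (ts≡ , r≡) → cong (node s) ts≡ , r≡) (parsesⱽ-complete f ts r refl degs≤f))
  parsesⱽ-complete f []       r eq _ = here (refl , sym eq)
  parsesⱽ-complete f (t ∷ ts) r eq degs≤f =
    Any.concatMap⁺ _ (Any.map tails (parses-complete f t (decorationsⱽ ts ++ r)
      (trans (sym (List.++-assoc (decorations t) (decorationsⱽ ts) r)) eq)
      (ℕ.≤-trans (ℕ.m≤m+n (deg ar t) (degs ar ts)) degs≤f)))
    where
    tails : ∀ {π} → term π ≡ t × rest π ≡ decorationsⱽ ts ++ r → Any _ (map (cons-parse π) (parsesⱽ f _ (rest π)))
    tails (refl , rest≡) = Any.gmap (λ (ts≡ , r≡) → cong (t ∷_) ts≡ , r≡)
      (parsesⱽ-complete f ts r (sym rest≡) (ℕ.≤-trans (ℕ.m≤n+m (degs ar ts) (deg ar t)) degs≤f))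

  module _ (t : Term ar) where

    fromParse : Parse (dc ar t) → Maybe (Down ar t)
    fromParse (parse u (_ ∷ _) _) = nothing
    fromParse (parse u []      eq) with Pointwise.decidable ℚ._≤?_ (cnc ar t) (cnc ar u)
    ... | yes t≤u = just (u , sym (trans (dc-decorations u) (trans (sym (List.++-identityʳ _)) eq)) , t≤u)
    ... | no  _   = nothing

    downElements : List (Down ar t)
    downElements = mapMaybe fromParse (parses (length (dc ar t)) (dc ar t))

    downElements-complete : ∀ (z : Down ar t) → Any (λ w → proj₁ z ≡ proj₁ w) downElements
    downElements-complete (u , dc≡ , t≤u) =
      Any.mapMaybe⁺ fromParse (parses (length (dc ar t)) (dc ar t)) (Any.gmap found (parses-complete _ u []
        (trans (List.++-identityʳ _) (trans (sym (dc-decorations u)) (sym dc≡)))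
        (ℕ.≤-reflexive (trans (sym (length-nodeInfo u))
          (trans (sym (List.length-map proj₁ (nodeInfo ar u))) (cong length (sym dc≡)))))))
      where
      found : ∀ {π} → term π ≡ u × rest π ≡ [] → Maybe.Any (λ w → u ≡ proj₁ w) (fromParse π)
      found {parse u [] eq} (refl , refl) with Pointwise.decidable ℚ._≤?_ (cnc ar t) (cnc ar u)
      ... | yes _   = Maybe.just refl
      ... | no  t≰u = contradiction t≤u t≰u

    sameDecorations : ∀ (x y : Down ar t) → SameDecorations (nodeInfo ar (proj₁ x)) (nodeInfo ar (proj₁ y))
    sameDecorations (_ , dc≡x , _) (_ , dc≡y , _) =
      Pointwise.map⁻ proj₁ proj₁ (Pointwise.≡⇒Pointwise-≡ (trans (sym dc≡x) dc≡y))

    joinWord : Down ar t → Down ar t → Word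
    joinWord x y = merge (nodeInfo ar (proj₁ x)) (nodeInfo ar (proj₁ y))

    nodeInfo-join : ∀ x y → nodeInfo ar (decode (joinWord x y)) ≡ joinWord x y
    nodeInfo-join x y =
      nodeInfo-decode (valid-merge (sameDecorations x y) (nodeInfo-valid (proj₁ x)) (nodeInfo-valid (proj₁ y)))

    dc-join : ∀ x y → dc ar (decode (joinWord x y)) ≡ dc ar (proj₁ x)
    dc-join x y = trans (cong (map proj₁) (nodeInfo-join x y)) (map-proj₁-merge (sameDecorations x y))

    cnc-join : ∀ x y → cnc ar (decode (joinWord x y)) ≡ maxWord ar (cnc ar (proj₁ x)) (cnc ar (proj₁ y))
    cnc-join x y = trans (cong (map proj₂) (nodeInfo-join x y)) (map-proj₂-merge _ _)

    cnc-length : ∀ (x y : Down ar t) → length (cnc ar (proj₁ x)) ≡ length (cnc ar (proj₁ y))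
    cnc-length (_ , _ , t≤x) (_ , _ , t≤y) = trans (sym (Pointwise.Pointwise-length t≤x)) (Pointwise.Pointwise-length t≤y)

    ≼-joinˡ : ∀ x y → _≼_ ar (proj₁ x) (decode (joinWord x y))
    ≼-joinˡ x y = sym (dc-join x y) , subst (Pointwise ℚ._≤_ _) (sym (cnc-join x y)) (⊔-upperˡ (cnc-length x y))

    ≼-joinʳ : ∀ x y → _≼_ ar (proj₁ y) (decode (joinWord x y))
    ≼-joinʳ x y = trans (trans (sym (proj₁ (proj₂ y))) (proj₁ (proj₂ x))) (sym (dc-join x y)) ,
                 subst (Pointwise ℚ._≤_ _) (sym (cnc-join x y)) (⊔-upperʳ (cnc-length x y))

    _∨_ : Op₂ (Down ar t)
    x ∨ y = decode (joinWord x y) , IsPartialOrder.trans ≼-isPartialOrder (proj₂ x) (≼-joinˡ x y)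

    ∨-supremum : Supremum (_≼↓_ ar) _∨_
    ∨-supremum x y = ≼-joinˡ x y , ≼-joinʳ x y , λ z (dc≡ , x≤z) (_ , y≤z) →
      trans (dc-join x y) dc≡ , subst (λ w → Pointwise ℚ._≤_ w _) (sym (cnc-join x y)) (⊔-least x≤z y≤z)

    ≼↓-isPartialOrder : IsPartialOrder (_≈↓_ ar {t}) (_≼↓_ ar)
    ≼↓-isPartialOrder = On.isPartialOrder proj₁ ≼-isPartialOrder

    _≼↓?_ : Decidable (_≼↓_ ar {t})
    x ≼↓? y = Dec.map′ (trans (sym (proj₁ (proj₂ x))) (proj₁ (proj₂ y)) ,_) proj₂
                (Pointwise.decidable ℚ._≤?_ (cnc ar (proj₁ x)) (cnc ar (proj₁ y)))

    bottom : Down ar t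
    bottom = t , refl , Pointwise.refl ℚ.≤-refl

    open MeetOfLowerBounds ≼↓-isPartialOrder _≼↓?_ {_∨_} ∨-supremum {bottom} proj₂ downElements downElements-complete
      public

theorem3p2p3 : {S : Set} (ar : S → ℕ) (t : Term ar) →
    Σ (Op₂ (Down ar t)) λ _∨_ →
    Σ (Op₂ (Down ar t)) λ _∧_ →
      IsLattice (_≈↓_ ar) (_≼↓_ ar) _∨_ _∧_
      × ((x y : Down ar t) →
           (dc ar (proj₁ (x ∨ y)) ≡ dc ar t)
           × (cnc ar (proj₁ (x ∨ y)) ≡ maxWord ar (cnc ar (proj₁ x)) (cnc ar (proj₁ y))))
theorem3p2p3 ar t =
  _∨_ ar t , _∧_ ar t ,
  record { isPartialOrder = ≼↓-isPartialOrder ar t ; supremum = ∨-supremum ar t ; infimum = ∧-infimum ar t } ,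
  λ x y → trans (dc-join ar t x y) (sym (proj₁ (proj₂ x))) , cnc-join ar t x y
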